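{- Let $G$ be a connected $(P_5,\text{chair})$-free graph and let $C=v_1v_2v_3v_4v_5$ be an induced $C_5$ in $G$ (indices modulo 5). For $1\le i\le 5$ define $S^2_3(i)=\{v\in V(G)\setminus V(C): N_C(v)=\{v_{i-2},v_i,v_{i+2}\}\}$, $S_4(i)=\{v\in V(G)\setminus V(C): N_C(v)=\{v_{i-2},v_{i-1},v_{i+1},v_{i+2}\}\}$ and $S_5=\{v\in V(G)\setminus V(C): N_C(v)=V(C)\}$. Then for every $1\le i\le 5$, each vertex in $S_4(i)\cup S_5$ is either complete or anticomplete to each connected component of $G[S^2_3(i)]$.
   Context: Graphs are finite and simple. $P_5$ is the path on 5 vertices; a chair is a $P_4$ with an additional vertex adjacent to exactly one of the two middle vertices of the $P_4$. $G$ is $(P_5,\text{chair})$-free if it has no induced subgraph isomorphic to $P_5$ or to the chair. $N_C(v)=N(v)\cap V(C)$. A vertex $x$ is complete (resp. anticomplete) to a set $X$ if $x$ is adjacent (resp. nonadjacent) to every vertex of $X$. -}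

module Defs where

open import Data.Nat using (ℕ; zero; suc; _∸_; _+_; _%_; _≡ᵇ_)
open import Data.Fin using (Fin; toℕ)
import Data.Fin
open import Data.Bool using (Bool; true; false; _∨_; _∧_; not)
open import Data.Product using (Σ; _×_; _,_)
open import Data.Sum using (_⊎_)
open import Data.Empty using (⊥)
open import Data.Unit using (⊤)
open import Relation.Nullary using (¬_)
open import Relation.Binary.PropositionalEquality using (_≡_)
open import Function.Definitions using (Injective)

record Graph : Set where
  field
    n      : ℕ
    adj    : Fin n → Fin n → Bool
    sym    : ∀ x y → adj x y ≡ adj y x
    irrefl : ∀ x → adj x x ≡ false
open Graph public

-- Walks staying inside a vertex set P (i.e. walks of the induced subgraph G[P]).
data Reach (G : Graph) (P : Fin (n G) → Set) : Fin (n G) → Fin (n G) → Set where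
  here : ∀ {x} → P x → Reach G P x x
  step : ∀ {x y z} → P x → adj G x y ≡ true → Reach G P y z → Reach G P x z

Connected : Graph → Set
Connected G = ∀ x y → Reach G (λ _ → ⊤) x y

HasInduced : (G : Graph) (k : ℕ) → (Fin k → Fin k → Bool) → Set
HasInduced G k H =
  Σ (Fin k → Fin (n G)) λ f →
    Injective _≡_ _≡_ f × (∀ i j → adj G (f i) (f j) ≡ H i j)

diff1 : ℕ → ℕ → Bool
diff1 a b = ((a ∸ b) ≡ᵇ 1) ∨ ((b ∸ a) ≡ᵇ 1)

P5adj : Fin 5 → Fin 5 → Bool
P5adj i j = diff1 (toℕ i) (toℕ j)

-- chair: path 0-1-2-3 plus vertex 4 adjacent exactly to 1 (a middle vertex)
chairAdj : Fin 5 → Fin 5 → Bool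
chairAdj i j =
  (diff1 a b ∧ not (a ≡ᵇ 4) ∧ not (b ≡ᵇ 4))
  ∨ ((a ≡ᵇ 1) ∧ (b ≡ᵇ 4)) ∨ ((a ≡ᵇ 4) ∧ (b ≡ᵇ 1))
  where a = toℕ i ; b = toℕ j

P5ChairFree : Graph → Set
P5ChairFree G = ¬ HasInduced G 5 P5adj × ¬ HasInduced G 5 chairAdj

-- offset (j - i) mod 5, so that c j = v_{i + offset i j}
offset : Fin 5 → Fin 5 → ℕ
offset i j = (toℕ j + 5 ∸ toℕ i) % 5

C5adj : Fin 5 → Fin 5 → Bool
C5adj i j = (offset i j ≡ᵇ 1) ∨ (offset i j ≡ᵇ 4)


Outside : (G : Graph) → (Fin 5 → Fin (n G)) → Fin (n G) → Set
Outside G c v = ∀ j → ¬ (v ≡ c j)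

-- N_C(v) = {v_{i+d} : pat d}
HasNC : (G : Graph) → (Fin 5 → Fin (n G)) → Fin 5 → (ℕ → Bool) → Fin (n G) → Set
HasNC G c i pat v = Outside G c v × (∀ j → adj G v (c j) ≡ pat (offset i j))

-- {i-2, i, i+2}: offsets 3, 0, 2
pat23 : ℕ → Bool
pat23 d = (d ≡ᵇ 0) ∨ (d ≡ᵇ 2) ∨ (d ≡ᵇ 3)

-- {i-2, i-1, i+1, i+2}: offsets 3, 4, 1, 2
pat4 : ℕ → Bool
pat4 d = not (d ≡ᵇ 0)

pat5 : ℕ → Bool
pat5 _ = true

S23 S4 : (G : Graph) → (Fin 5 → Fin (n G)) → Fin 5 → Fin (n G) → Set
S23 G c i = HasNC G c i pat23
S4  G c i = HasNC G c i pat4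

S5 : (G : Graph) → (Fin 5 → Fin (n G)) → Fin (n G) → Set
S5 G c = HasNC G c (Data.Fin.zero) pat5

module Submission where

-- Let x, y be adjacent vertices of the component of G[S²₃(i)] with v ~ x and v ≁ y.
-- The vertices v_{i-1}, v_{i+1} of C are nonadjacent, adjacent to v (v ∈ S₄(i) ∪ S₅)
-- and nonadjacent to x and y (x, y ∈ S²₃(i)), so v_{i+1} - v - x - y together with
-- v_{i-1} hanging off v is an induced chair.  Hence adjacency to v is constant along
-- the edges of G[S²₃(i)], and therefore on each of its components.

open import Defs hiding (sym)
open import Data.Fin using (Fin; zero; suc; _≟_)
open import Data.Fin.Properties using (all?; any?)
open import Data.Bool using (Bool; true; false)
import Data.Bool.Properties as Bool
open import Data.Product using (Σ-syntax; _×_; _,_; proj₂)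
open import Data.Sum using (_⊎_; inj₁; inj₂)
open import Data.Empty using (⊥-elim)
open import Relation.Nullary using (¬_; ¬?)
open import Relation.Nullary.Decidable using (toWitness; _×-dec_; _⊎-dec_)
open import Relation.Binary.PropositionalEquality
  using (_≡_; _≢_; refl; sym; trans; cong)

module _ (G : Graph) where

  Reach-invariant : ∀ {P : Fin (n G) → Set} (φ : Fin (n G) → Bool) →
    (∀ x y → P x → P y → adj G x y ≡ true → φ x ≡ φ y) →
    ∀ {x y} → Reach G P x y → φ x ≡ φ y
  Reach-invariant φ preserved (here _) = refl
  Reach-invariant φ preserved (step Px xy r) =
    trans (preserved _ _ Px (Reach-source r) xy) (Reach-invariant φ preserved r)
    where
    Reach-source : ∀ {P : Fin (n G) → Set} {x y} → Reach G P x y → P x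
    Reach-source (here Px)     = Px
    Reach-source (step Px _ _) = Px

  module _ {k} (H : Fin k → Fin k → Bool) (f : Fin k → Fin (n G))
    (realizes : ∀ i j → adj G (f i) (f j) ≡ H i j) where

    rows-agree : ∀ {i j} → f i ≡ f j → ∀ l → H i l ≡ H j l
    rows-agree {i} {j} fi≡fj l =
      trans (sym (realizes i l)) (trans (cong (λ w → adj G w (f l)) fi≡fj) (realizes j l))

four : Fin 5
four = suc (suc (suc (suc zero)))

-- Apart from the two leaves 0 and 4 at the middle vertex 1, the chair has no twins.
chair-separated : ∀ i j → i ≡ j ⊎ (i ≡ zero × j ≡ four) ⊎ (i ≡ four × j ≡ zero)
  ⊎ Σ[ l ∈ Fin 5 ] chairAdj i l ≢ chairAdj j l
chair-separated = toWitness {a? = all? λ i → all? λ j →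
  (i ≟ j) ⊎-dec ((i ≟ zero) ×-dec (j ≟ four)) ⊎-dec ((i ≟ four) ×-dec (j ≟ zero))
  ⊎-dec any? (λ l → ¬? (chairAdj i l Bool.≟ chairAdj j l))} _

module _ (G : Graph) where

  private
    _~_ : Fin (n G) → Fin (n G) → Bool
    _~_ = adj G

  induced-chair : ∀ {p q v x y} → p ≢ q →
    v ~ p ≡ true → v ~ q ≡ true → p ~ q ≡ false →
    x ~ p ≡ false → x ~ q ≡ false → y ~ p ≡ false → y ~ q ≡ false →
    x ~ y ≡ true → v ~ x ≡ true → v ~ y ≡ false →
    HasInduced G 5 chairAdj
  induced-chair {p} {q} {v} {x} {y} p≢q vp vq pq xp xq yp yq xy vx vy =
    f , injective , realizes
    where
    f : Fin 5 → Fin (n G)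
    f zero                         = p
    f (suc zero)                   = v
    f (suc (suc zero))             = x
    f (suc (suc (suc zero)))       = y
    f (suc (suc (suc (suc zero)))) = q

    flip : ∀ {a b c} → a ~ b ≡ c → b ~ a ≡ c
    flip {a} {b} ab = trans (Graph.sym G b a) ab

    realizes : ∀ i j → f i ~ f j ≡ chairAdj i j
    realizes zero                         zero                         = irrefl G p
    realizes zero                         (suc zero)                   = flip vp
    realizes zero                         (suc (suc zero))             = flip xp
    realizes zero                         (suc (suc (suc zero)))       = flip yp
    realizes zero                         (suc (suc (suc (suc zero)))) = pq
    realizes (suc zero)                   zero                         = vp
    realizes (suc zero)                   (suc zero)                   = irrefl G v
    realizes (suc zero)                   (suc (suc zero))             = vx
    realizes (suc zero)                   (suc (suc (suc zero)))       = vy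
    realizes (suc zero)                   (suc (suc (suc (suc zero)))) = vq
    realizes (suc (suc zero))             zero                         = xp
    realizes (suc (suc zero))             (suc zero)                   = flip vx
    realizes (suc (suc zero))             (suc (suc zero))             = irrefl G x
    realizes (suc (suc zero))             (suc (suc (suc zero)))       = xy
    realizes (suc (suc zero))             (suc (suc (suc (suc zero)))) = xq
    realizes (suc (suc (suc zero)))       zero                         = yp
    realizes (suc (suc (suc zero)))       (suc zero)                   = flip vy
    realizes (suc (suc (suc zero)))       (suc (suc zero))             = flip xy
    realizes (suc (suc (suc zero)))       (suc (suc (suc zero)))       = irrefl G y
    realizes (suc (suc (suc zero)))       (suc (suc (suc (suc zero)))) = yq
    realizes (suc (suc (suc (suc zero)))) zero                         = flip pq
    realizes (suc (suc (suc (suc zero)))) (suc zero)                   = flip vq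
    realizes (suc (suc (suc (suc zero)))) (suc (suc zero))             = flip xq
    realizes (suc (suc (suc (suc zero)))) (suc (suc (suc zero)))       = flip yq
    realizes (suc (suc (suc (suc zero)))) (suc (suc (suc (suc zero)))) = irrefl G q

    injective : ∀ {i j} → f i ≡ f j → i ≡ j
    injective {i} {j} fi≡fj with chair-separated i j
    ... | inj₁ i≡j                            = i≡j
    ... | inj₂ (inj₁ (refl , refl))           = ⊥-elim (p≢q fi≡fj)
    ... | inj₂ (inj₂ (inj₁ (refl , refl)))    = ⊥-elim (p≢q (sym fi≡fj))
    ... | inj₂ (inj₂ (inj₂ (l , rows-differ))) =
      ⊥-elim (rows-differ (rows-agree G chairAdj f realizes fi≡fj l))

C5-flanks : ∀ i → Σ[ a ∈ Fin 5 ] Σ[ b ∈ Fin 5 ]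
  offset i a ≡ 1 × offset i b ≡ 4 × C5adj a b ≡ false × a ≢ b
C5-flanks zero                         = suc zero , four , refl , refl , refl , λ ()
C5-flanks (suc zero)                   = suc (suc zero) , zero , refl , refl , refl , λ ()
C5-flanks (suc (suc zero))             = suc (suc (suc zero)) , suc zero , refl , refl , refl , λ ()
C5-flanks (suc (suc (suc zero)))       = four , suc (suc zero) , refl , refl , refl , λ ()
C5-flanks (suc (suc (suc (suc zero)))) = zero , suc (suc (suc zero)) , refl , refl , refl , λ ()

module _ (G : Graph) (c : Fin 5 → Fin (n G))
  (c-induced : ∀ a b → adj G (c a) (c b) ≡ C5adj a b)
  (c-injective : ∀ a b → c a ≡ c b → a ≡ b) where

  S4⊎S5-adj : ∀ {i v} → S4 G c i v ⊎ S5 G c v → ∀ j → pat4 (offset i j) ≡ true →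
    adj G v (c j) ≡ true
  S4⊎S5-adj (inj₁ v∈S4) j in-pat = trans (proj₂ v∈S4 j) in-pat
  S4⊎S5-adj (inj₂ v∈S5) j _      = proj₂ v∈S5 j

  S23-nonadj : ∀ {i x} → S23 G c i x → ∀ j → pat23 (offset i j) ≡ false →
    adj G x (c j) ≡ false
  S23-nonadj x∈S23 j out-pat = trans (proj₂ x∈S23 j) out-pat

  chair-at-split-edge : ∀ {i v x y} → S4 G c i v ⊎ S5 G c v →
    S23 G c i x → S23 G c i y →
    adj G x y ≡ true → adj G v x ≡ true → adj G v y ≡ false →
    HasInduced G 5 chairAdj
  chair-at-split-edge {i} v∈S45 x∈S23 y∈S23 xy vx vy with C5-flanks i
  ... | a , b , oa , ob , ab , a≢b =
    induced-chair G (λ ca≡cb → a≢b (c-injective a b ca≡cb))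
      (S4⊎S5-adj {i} v∈S45 a (cong pat4 oa)) (S4⊎S5-adj {i} v∈S45 b (cong pat4 ob))
      (trans (c-induced a b) ab)
      (S23-nonadj {i} x∈S23 a (cong pat23 oa)) (S23-nonadj {i} x∈S23 b (cong pat23 ob))
      (S23-nonadj {i} y∈S23 a (cong pat23 oa)) (S23-nonadj {i} y∈S23 b (cong pat23 ob))
      xy vx vy

  S4⊎S5-adj-constant-on-S23-edges : ¬ HasInduced G 5 chairAdj → ∀ {i v} → S4 G c i v ⊎ S5 G c v →
    ∀ x y → S23 G c i x → S23 G c i y → adj G x y ≡ true → adj G v x ≡ adj G v y
  S4⊎S5-adj-constant-on-S23-edges chair-free {i} {v} v∈S45 x y x∈S23 y∈S23 xy
    with adj G v x in vx | adj G v y in vy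
  ... | true  | true  = refl
  ... | false | false = refl
  ... | true  | false = ⊥-elim (chair-free (chair-at-split-edge {i} v∈S45 x∈S23 y∈S23 xy vx vy))
  ... | false | true  = ⊥-elim (chair-free (chair-at-split-edge {i} v∈S45 y∈S23 x∈S23 yx vy vx))
    where
    yx : adj G y x ≡ true
    yx = trans (Graph.sym G y x) xy

claim4 : (G : Graph) → Connected G → P5ChairFree G →
    (c : Fin 5 → Fin (n G)) →
    (∀ a b → adj G (c a) (c b) ≡ C5adj a b) → (∀ a b → c a ≡ c b → a ≡ b) →
    (i : Fin 5) (v : Fin (n G)) → (S4 G c i v ⊎ S5 G c v) →
    (u : Fin (n G)) → S23 G c i u →
    (∀ y → Reach G (S23 G c i) u y → adj G v y ≡ true)
    ⊎ (∀ y → Reach G (S23 G c i) u y → adj G v y ≡ false)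
claim4 G _ (_ , chair-free) c c-induced c-injective i v v∈S45 u _ =
  by-value (adj G v u) λ y u⇝y → sym (Reach-invariant G (adj G v)
    (S4⊎S5-adj-constant-on-S23-edges G c c-induced c-injective chair-free {i} v∈S45) u⇝y)
  where
  by-value : ∀ b → (∀ y → Reach G (S23 G c i) u y → adj G v y ≡ b) →
    (∀ y → Reach G (S23 G c i) u y → adj G v y ≡ true)
    ⊎ (∀ y → Reach G (S23 G c i) u y → adj G v y ≡ false)
  by-value true  = inj₁
  by-value false = inj₂
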